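{- Cut is admissible in each super-Belnap calculus: if $C$ is a super-Belnap calculus and a sequent is derivable from the empty set of premises in $C$ extended by Cut, then it is derivable from the empty set of premises in $C$.
   Context: Formulas are built from atoms using $\wedge,\vee,{ - },\top,\bot$; a sequent $\Gamma\vartriangleright\Delta$ is a pair of finite multisets of formulas; it is atomic if all its formulas are atoms. The calculus $G\mathcal{B}$ consists of: introduction rules (from $\Gamma\vartriangleright\Delta,\varphi$ and $\Gamma\vartriangleright\Delta,\psi$ infer $\Gamma\vartriangleright\Delta,\varphi\wedge\psi$; from $\varphi,\psi,\Gamma\vartriangleright\Delta$ infer $\varphi\wedge\psi,\Gamma\vartriangleright\Delta$; from $\varphi,\Gamma\vartriangleright\Delta$ and $\psi,\Gamma\vartriangleright\Delta$ infer $\varphi\vee\psi,\Gamma\vartriangleright\Delta$; from $\Gamma\vartriangleright\Delta,\varphi,\psi$ infer $\Gamma\vartriangleright\Delta,\varphi\vee\psi$; from $\varphi,\Gamma\vartriangleright\Delta$ infer $\Gamma\vartriangleright\Delta,{ - }\varphi$; from $\Gamma\vartriangleright\Delta,\varphi$ infer ${ - }\varphi,\Gamma\vartriangleright\Delta$; axioms $\emptyset\vartriangleright\top$, $\bot\vartriangleright\emptyset$); elimination rules (the inverses of each of these two-way rules, e.g. from $\Gamma\vartriangleright\Delta,\varphi\wedge\psi$ infer $\Gamma\vartriangleright\Delta,\varphi$ and also $\Gamma\vartriangleright\Delta,\psi$, and from $\varphi\vee\psi,\Gamma\vartriangleright\Delta$ infer $\varphi,\Gamma\vartriangleright\Delta$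 and also $\psi,\Gamma\vartriangleright\Delta$; plus from $\top,\Gamma\vartriangleright\Delta$ infer $\Gamma\vartriangleright\Delta$ and from $\Gamma\vartriangleright\Delta,\bot$ infer $\Gamma\vartriangleright\Delta$); and Weakening and Contraction on both sides. A structural rule is a rule (possibly with infinitely many premises) whose premises and conclusion are atomic sequents, applied in all its substitution instances. A super-Belnap calculus is $G\mathcal{B}$ extended by an arbitrary set of structural rules; proofs are well-founded labelled trees. Cut: from $\Gamma\vartriangleright\Delta,\varphi$ and $\varphi,\Gamma'\vartriangleright\Delta'$ infer $\Gamma,\Gamma'\vartriangleright\Delta,\Delta'$. -}

module Defs where

open import Data.Nat using (ℕ)
open import Data.Bool using (Bool; true; false)
open import Data.List using (List; []; _∷_; _++_; map)
open import Data.List.Relation.Binary.Permutation.Propositional using (_↭_)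
open import Relation.Binary.PropositionalEquality using (_≡_)

Atom : Set
Atom = ℕ

data Fm : Set where
  atom : Atom → Fm
  _∧̇_  : Fm → Fm → Fm
  _∨̇_  : Fm → Fm → Fm
  -̇_   : Fm → Fm
  ⊤̇    : Fm
  ⊥̇    : Fm

infixr 6 _∧̇_
infixr 5 _∨̇_
infix  7 -̇_

-- Finite multisets are represented by lists; the
-- calculus contains an exchange rule (permutation of either side), so that
-- derivability is invariant under the order of list elements, i.e. sequents
-- are effectively pairs of multisets.
data Seq : Set where
  _▷_ : List Fm → List Fm → Seq

infix 4 _▷_

data ASeq : Set where
  _▷ᵃ_ : List Atom → List Atom → ASeq

Subst : Set
Subst = Atom → Fm

inst : Subst → ASeq → Seq
inst σ (Γ ▷ᵃ Δ) = map σ Γ ▷ map σ Δ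

record StructRule : Set₁ where
  field
    Prem  : Set
    prem  : Prem → ASeq
    concl : ASeq

-- A super-Belnap calculus: GB extended by an arbitrary set of structural
-- rules (given as an indexed family).
record Calculus : Set₁ where
  field
    Idx  : Set
    rule : Idx → StructRule

open StructRule
open Calculus

data Der (C : Calculus) (withCut : Bool) : Seq → Set where
  ∧R  : ∀ {Γ Δ φ ψ} → Der C withCut (Γ ▷ φ ∷ Δ) → Der C withCut (Γ ▷ ψ ∷ Δ)
        → Der C withCut (Γ ▷ (φ ∧̇ ψ) ∷ Δ)
  ∧L  : ∀ {Γ Δ φ ψ} → Der C withCut (φ ∷ ψ ∷ Γ ▷ Δ) → Der C withCut ((φ ∧̇ ψ) ∷ Γ ▷ Δ)
  ∨L  : ∀ {Γ Δ φ ψ} → Der C withCut (φ ∷ Γ ▷ Δ) → Der C withCut (ψ ∷ Γ ▷ Δ)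
        → Der C withCut ((φ ∨̇ ψ) ∷ Γ ▷ Δ)
  ∨R  : ∀ {Γ Δ φ ψ} → Der C withCut (Γ ▷ φ ∷ ψ ∷ Δ) → Der C withCut (Γ ▷ (φ ∨̇ ψ) ∷ Δ)
  -R  : ∀ {Γ Δ φ} → Der C withCut (φ ∷ Γ ▷ Δ) → Der C withCut (Γ ▷ (-̇ φ) ∷ Δ)
  -L  : ∀ {Γ Δ φ} → Der C withCut (Γ ▷ φ ∷ Δ) → Der C withCut ((-̇ φ) ∷ Γ ▷ Δ)
  ⊤R  : Der C withCut ([] ▷ ⊤̇ ∷ [])
  ⊥L  : Der C withCut (⊥̇ ∷ [] ▷ [])
  ∧R-e₁ : ∀ {Γ Δ φ ψ} → Der C withCut (Γ ▷ (φ ∧̇ ψ) ∷ Δ) → Der C withCut (Γ ▷ φ ∷ Δ)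
  ∧R-e₂ : ∀ {Γ Δ φ ψ} → Der C withCut (Γ ▷ (φ ∧̇ ψ) ∷ Δ) → Der C withCut (Γ ▷ ψ ∷ Δ)
  ∧L-e  : ∀ {Γ Δ φ ψ} → Der C withCut ((φ ∧̇ ψ) ∷ Γ ▷ Δ) → Der C withCut (φ ∷ ψ ∷ Γ ▷ Δ)
  ∨L-e₁ : ∀ {Γ Δ φ ψ} → Der C withCut ((φ ∨̇ ψ) ∷ Γ ▷ Δ) → Der C withCut (φ ∷ Γ ▷ Δ)
  ∨L-e₂ : ∀ {Γ Δ φ ψ} → Der C withCut ((φ ∨̇ ψ) ∷ Γ ▷ Δ) → Der C withCut (ψ ∷ Γ ▷ Δ)
  ∨R-e  : ∀ {Γ Δ φ ψ} → Der C withCut (Γ ▷ (φ ∨̇ ψ) ∷ Δ) → Der C withCut (Γ ▷ φ ∷ ψ ∷ Δ)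
  -R-e  : ∀ {Γ Δ φ} → Der C withCut (Γ ▷ (-̇ φ) ∷ Δ) → Der C withCut (φ ∷ Γ ▷ Δ)
  -L-e  : ∀ {Γ Δ φ} → Der C withCut ((-̇ φ) ∷ Γ ▷ Δ) → Der C withCut (Γ ▷ φ ∷ Δ)
  ⊤L-e  : ∀ {Γ Δ} → Der C withCut (⊤̇ ∷ Γ ▷ Δ) → Der C withCut (Γ ▷ Δ)
  ⊥R-e  : ∀ {Γ Δ} → Der C withCut (Γ ▷ ⊥̇ ∷ Δ) → Der C withCut (Γ ▷ Δ)
  WL : ∀ {Γ Δ φ} → Der C withCut (Γ ▷ Δ) → Der C withCut (φ ∷ Γ ▷ Δ)
  WR : ∀ {Γ Δ φ} → Der C withCut (Γ ▷ Δ) → Der C withCut (Γ ▷ φ ∷ Δ)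
  CL : ∀ {Γ Δ φ} → Der C withCut (φ ∷ φ ∷ Γ ▷ Δ) → Der C withCut (φ ∷ Γ ▷ Δ)
  CR : ∀ {Γ Δ φ} → Der C withCut (Γ ▷ φ ∷ φ ∷ Δ) → Der C withCut (Γ ▷ φ ∷ Δ)
  Ex : ∀ {Γ Γ' Δ Δ'} → Γ ↭ Γ' → Δ ↭ Δ' → Der C withCut (Γ ▷ Δ) → Der C withCut (Γ' ▷ Δ')
  St : (i : Idx C) (σ : Subst)
       → ((j : Prem (rule C i)) → Der C withCut (inst σ (prem (rule C i) j)))
       → Der C withCut (inst σ (concl (rule C i)))
  Cut : ∀ {Γ Δ Γ' Δ' φ} → withCut ≡ true
        → Der C withCut (Γ ▷ φ ∷ Δ) → Der C withCut (φ ∷ Γ' ▷ Δ')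
        → Der C withCut (Γ ++ Γ' ▷ Δ ++ Δ')

-- Every logical rule of GB is invertible, so a cut on a compound formula reduces
-- to cuts on its immediate subformulas; this is cleanest for the context-sharing
-- form of cut, from which the rule Cut follows by weakening.  For an atomic cut
-- formula p, invert all logical rules in the left premise Γ ▷ p, Δ.  Branches in
-- which p surfaces on the left are closed by the right premise p, Γ' ▷ Δ' and
-- weakening.  In the remaining atomic branches A ▷ p, B with p ∉ A, substituting
-- ⊥ for p (derivability is closed under substitution, because structural rules
-- are applied in all their substitution instances) leaves A unchanged and turns
-- p into ⊥, which is eliminated: A ▷ B is derivable already.
module Submission where

open import Defs
open import Data.Bool using (Bool; true; false)
open import Data.List using (List; []; _∷_; _++_; map; [_])
open import Data.List.Properties using (map-∘; map-++; ++-identityʳ)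
open import Data.List.Membership.Propositional using (_∈_)
open import Data.List.Membership.Propositional.Properties using (∈-∃++; ∈-++⁻; ∈-++⁺ʳ)
open import Data.List.Relation.Unary.All using (All; []; _∷_)
open import Data.List.Relation.Unary.Any using (here; there)
open import Data.List.Relation.Binary.Subset.Propositional using (_⊆_)
open import Data.List.Relation.Binary.Subset.Propositional.Properties
  using (⊆-reflexive; xs⊆x∷xs; ∷⁺ʳ; xs⊆xs++ys; xs⊆ys++xs)
open import Data.List.Relation.Binary.Permutation.Propositional
  using (_↭_; ↭-refl; ↭-sym; ↭-trans; ↭-reflexive; ↭-prep; ↭-swap)
open import Data.List.Relation.Binary.Permutation.Propositional.Properties
  using (shift; ++-comm; ++⁺ˡ; map⁺)
open import Data.Nat.Properties using (_≟_)
open import Data.Product using (_,_)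
open import Data.Sum using (reduce)
open import Function using (_∘_)
open import Relation.Binary.PropositionalEquality using (_≡_; _≢_; refl; sym; cong; cong₂; subst)
open import Relation.Nullary using (yes; no; contradiction)

open StructRule
open Calculus

sub : Subst → Fm → Fm
sub σ (atom a) = σ a
sub σ (φ ∧̇ ψ)  = sub σ φ ∧̇ sub σ ψ
sub σ (φ ∨̇ ψ)  = sub σ φ ∨̇ sub σ ψ
sub σ (-̇ φ)    = -̇ sub σ φ
sub σ ⊤̇        = ⊤̇
sub σ ⊥̇        = ⊥̇

subˢ : Subst → Seq → Seq
subˢ σ (Γ ▷ Δ) = map (sub σ) Γ ▷ map (sub σ) Δ

subˢ-inst : ∀ σ τ s → subˢ σ (inst τ s) ≡ inst (sub σ ∘ τ) s
subˢ-inst σ τ (Γ ▷ᵃ Δ) = cong₂ _▷_ (sym (map-∘ Γ)) (sym (map-∘ Δ))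

subˢ-++ : ∀ σ Γ Γ' Δ Δ' →
  subˢ σ (Γ ++ Γ' ▷ Δ ++ Δ') ≡ (map (sub σ) Γ ++ map (sub σ) Γ' ▷ map (sub σ) Δ ++ map (sub σ) Δ')
subˢ-++ σ Γ Γ' Δ Δ' = cong₂ _▷_ (map-++ (sub σ) Γ Γ') (map-++ (sub σ) Δ Δ')

atoms : List Atom → List Fm
atoms = map atom

falsify : Atom → Subst
falsify p a with a ≟ p
... | yes _ = ⊥̇
... | no _  = atom a

falsify-self : ∀ p → falsify p p ≡ ⊥̇
falsify-self p with p ≟ p
... | yes _   = refl
... | no p≢p = contradiction refl p≢p

falsify-fresh : ∀ {p} A → All (_≢ p) A → map (sub (falsify p)) (atoms A) ≡ atoms A
falsify-fresh []      []          = refl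
falsify-fresh {p} (a ∷ A) (a≢p ∷ A≢p) with a ≟ p
... | yes a≡p = contradiction a≡p a≢p
... | no _    = cong (atom a ∷_) (falsify-fresh A A≢p)

falsify-⊆ : ∀ p B → map (sub (falsify p)) (atoms B) ⊆ ⊥̇ ∷ atoms B
falsify-⊆ p (b ∷ B) (here refl) with b ≟ p
... | yes _ = here refl
... | no _  = there (here refl)
falsify-⊆ p (b ∷ B) (there x∈B) = ∷⁺ʳ ⊥̇ (xs⊆x∷xs (atoms B) (atom b)) (falsify-⊆ p B x∈B)

module _ {C : Calculus} {b : Bool} where

  private
    D : Seq → Set
    D = Der C b

  Der-sub : ∀ σ {s} → D s → D (subˢ σ s)
  Der-sub σ (∧R d e)   = ∧R (Der-sub σ d) (Der-sub σ e)
  Der-sub σ (∧L d)     = ∧L (Der-sub σ d)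
  Der-sub σ (∨L d e)   = ∨L (Der-sub σ d) (Der-sub σ e)
  Der-sub σ (∨R d)     = ∨R (Der-sub σ d)
  Der-sub σ (-R d)     = -R (Der-sub σ d)
  Der-sub σ (-L d)     = -L (Der-sub σ d)
  Der-sub σ ⊤R         = ⊤R
  Der-sub σ ⊥L         = ⊥L
  Der-sub σ (∧R-e₁ d)  = ∧R-e₁ (Der-sub σ d)
  Der-sub σ (∧R-e₂ d)  = ∧R-e₂ (Der-sub σ d)
  Der-sub σ (∧L-e d)   = ∧L-e (Der-sub σ d)
  Der-sub σ (∨L-e₁ d)  = ∨L-e₁ (Der-sub σ d)
  Der-sub σ (∨L-e₂ d)  = ∨L-e₂ (Der-sub σ d)
  Der-sub σ (∨R-e d)   = ∨R-e (Der-sub σ d)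
  Der-sub σ (-R-e d)   = -R-e (Der-sub σ d)
  Der-sub σ (-L-e d)   = -L-e (Der-sub σ d)
  Der-sub σ (⊤L-e d)   = ⊤L-e (Der-sub σ d)
  Der-sub σ (⊥R-e d)   = ⊥R-e (Der-sub σ d)
  Der-sub σ (WL d)     = WL (Der-sub σ d)
  Der-sub σ (WR d)     = WR (Der-sub σ d)
  Der-sub σ (CL d)     = CL (Der-sub σ d)
  Der-sub σ (CR d)     = CR (Der-sub σ d)
  Der-sub σ (Ex π ρ d) = Ex (map⁺ (sub σ) π) (map⁺ (sub σ) ρ) (Der-sub σ d)
  Der-sub σ (St i τ ds) =
    subst D (sym (subˢ-inst σ τ (concl (rule C i))))
      (St i (sub σ ∘ τ) λ j → subst D (subˢ-inst σ τ (prem (rule C i) j)) (Der-sub σ (ds j)))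
  Der-sub σ (Cut {Γ} {Δ} {Γ'} {Δ'} enabled d e) =
    subst D (sym (subˢ-++ σ Γ Γ' Δ Δ')) (Cut enabled (Der-sub σ d) (Der-sub σ e))

  weakenˡ : ∀ X {Γ Δ} → D (Γ ▷ Δ) → D (X ++ Γ ▷ Δ)
  weakenˡ []      d = d
  weakenˡ (_ ∷ X) d = WL (weakenˡ X d)

  weakenʳ : ∀ Y {Γ Δ} → D (Γ ▷ Δ) → D (Γ ▷ Y ++ Δ)
  weakenʳ []      d = d
  weakenʳ (_ ∷ Y) d = WR (weakenʳ Y d)

  contractˡ : ∀ {φ Γ Δ} → φ ∈ Γ → D (φ ∷ Γ ▷ Δ) → D (Γ ▷ Δ)
  contractˡ {φ} φ∈Γ d with ys , zs , refl ← ∈-∃++ φ∈Γ =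
    Ex (↭-sym (shift φ ys zs)) ↭-refl (CL (Ex (↭-prep φ (shift φ ys zs)) ↭-refl d))

  contractʳ : ∀ {φ Γ Δ} → φ ∈ Δ → D (Γ ▷ φ ∷ Δ) → D (Γ ▷ Δ)
  contractʳ {φ} φ∈Δ d with ys , zs , refl ← ∈-∃++ φ∈Δ =
    Ex ↭-refl (↭-sym (shift φ ys zs)) (CR (Ex ↭-refl (↭-prep φ (shift φ ys zs)) d))

  absorbˡ : ∀ {X Γ Δ} → X ⊆ Γ → D (X ++ Γ ▷ Δ) → D (Γ ▷ Δ)
  absorbˡ {[]}    _   d = d
  absorbˡ {_ ∷ X} X⊆Γ d = absorbˡ (X⊆Γ ∘ there) (contractˡ (∈-++⁺ʳ X (X⊆Γ (here refl))) d)

  absorbʳ : ∀ {Y Γ Δ} → Y ⊆ Δ → D (Γ ▷ Y ++ Δ) → D (Γ ▷ Δ)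
  absorbʳ {[]}    _   d = d
  absorbʳ {_ ∷ Y} Y⊆Δ d = absorbʳ (Y⊆Δ ∘ there) (contractʳ (∈-++⁺ʳ Y (Y⊆Δ (here refl))) d)

  weaken-⊆ : ∀ {Γ Γ' Δ Δ'} → Γ ⊆ Γ' → Δ ⊆ Δ' → D (Γ ▷ Δ) → D (Γ' ▷ Δ')
  weaken-⊆ {Γ} {Γ'} {Δ} {Δ'} Γ⊆Γ' Δ⊆Δ' d =
    absorbˡ Γ⊆Γ' (absorbʳ Δ⊆Δ' (Ex (++-comm Γ' Γ) (++-comm Δ' Δ) (weakenˡ Γ' (weakenʳ Δ' d))))

  drop-atomʳ : ∀ {p} A B → All (_≢ p) A → D (atoms A ▷ atom p ∷ atoms B) → D (atoms A ▷ atoms B)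
  drop-atomʳ {p} A B A≢p d =
    ⊥R-e (weaken-⊆ (⊆-reflexive (falsify-fresh A A≢p)) p↦⊥ (Der-sub (falsify p) d))
    where
    p↦⊥ : map (sub (falsify p)) (atoms (p ∷ B)) ⊆ ⊥̇ ∷ atoms B
    p↦⊥ (here refl)  = here (falsify-self p)
    p↦⊥ (there x∈B) = falsify-⊆ p B x∈B

  module AtomicCut {p : Atom} {Γ' Δ' : List Fm} (e : D (atom p ∷ Γ' ▷ Δ')) where

    -- A and B collect the atoms split off so far; p never enters A, because a
    -- left occurrence of p is closed by e at once.
    Reducible : List Fm → List Fm → Set
    Reducible Γ Δ = ∀ A B → All (_≢ p) A
      → D (Γ ++ atoms A ▷ Δ ++ atom p ∷ atoms B)
      → D (Γ ++ atoms A ++ Γ' ▷ Δ ++ atoms B ++ Δ')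

    reducible-atomic : Reducible [] []
    reducible-atomic A B A≢p d =
      weaken-⊆ (xs⊆xs++ys (atoms A) Γ') (xs⊆xs++ys (atoms B) Δ') (drop-atomʳ A B A≢p d)

    reducible-∷ˡ : ∀ φ {Γ Δ} → Reducible Γ Δ → Reducible (φ ∷ Γ) Δ
    reducible-∷ʳ : ∀ φ {Γ Δ} → Reducible Γ Δ → Reducible Γ (φ ∷ Δ)

    reducible-∷ˡ (atom q) {Γ} {Δ} red A B A≢p d with q ≟ p
    ... | yes refl =
      weaken-⊆ (∷⁺ʳ (atom p) (xs⊆ys++xs _ Γ ∘ xs⊆ys++xs Γ' (atoms A)))
               (xs⊆ys++xs _ Δ ∘ xs⊆ys++xs Δ' (atoms B)) e
    ... | no q≢p =
      Ex (shift (atom q) Γ (atoms A ++ Γ')) ↭-refl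
        (red (q ∷ A) B (q≢p ∷ A≢p) (Ex (↭-sym (shift (atom q) Γ (atoms A))) ↭-refl d))
    reducible-∷ˡ (φ ∧̇ ψ) red A B A≢p d = ∧L (reducible-∷ˡ φ (reducible-∷ˡ ψ red) A B A≢p (∧L-e d))
    reducible-∷ˡ (φ ∨̇ ψ) red A B A≢p d =
      ∨L (reducible-∷ˡ φ red A B A≢p (∨L-e₁ d)) (reducible-∷ˡ ψ red A B A≢p (∨L-e₂ d))
    reducible-∷ˡ (-̇ φ)   red A B A≢p d = -L (reducible-∷ʳ φ red A B A≢p (-L-e d))
    reducible-∷ˡ ⊤̇       red A B A≢p d = WL (red A B A≢p (⊤L-e d))
    reducible-∷ˡ ⊥̇       red A B A≢p d = weaken-⊆ (∷⁺ʳ ⊥̇ λ ()) (λ ()) ⊥L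

    reducible-∷ʳ (atom r) {Γ} {Δ} red A B A≢p d =
      Ex ↭-refl (shift (atom r) Δ (atoms B ++ Δ'))
        (red A (r ∷ B) A≢p (Ex ↭-refl r↭ d))
      where
      r↭ : atom r ∷ Δ ++ atom p ∷ atoms B ↭ Δ ++ atom p ∷ atom r ∷ atoms B
      r↭ = ↭-trans (↭-sym (shift (atom r) Δ (atom p ∷ atoms B))) (++⁺ˡ Δ (↭-swap (atom r) (atom p) ↭-refl))
    reducible-∷ʳ (φ ∧̇ ψ) red A B A≢p d =
      ∧R (reducible-∷ʳ φ red A B A≢p (∧R-e₁ d)) (reducible-∷ʳ ψ red A B A≢p (∧R-e₂ d))
    reducible-∷ʳ (φ ∨̇ ψ) red A B A≢p d = ∨R (reducible-∷ʳ φ (reducible-∷ʳ ψ red) A B A≢p (∨R-e d))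
    reducible-∷ʳ (-̇ φ)   red A B A≢p d = -R (reducible-∷ˡ φ red A B A≢p (-R-e d))
    reducible-∷ʳ ⊤̇       red A B A≢p d = weaken-⊆ (λ ()) (∷⁺ʳ ⊤̇ λ ()) ⊤R
    reducible-∷ʳ ⊥̇       red A B A≢p d = WR (red A B A≢p (⊥R-e d))

    reducible : ∀ Γ Δ → Reducible Γ Δ
    reducible (φ ∷ Γ) Δ       = reducible-∷ˡ φ (reducible Γ Δ)
    reducible []      (ψ ∷ Δ) = reducible-∷ʳ ψ (reducible [] Δ)
    reducible []      []      = reducible-atomic

  cut-atom : ∀ {p Γ Δ Γ' Δ'} → D (Γ ▷ atom p ∷ Δ) → D (atom p ∷ Γ' ▷ Δ') → D (Γ ++ Γ' ▷ Δ ++ Δ')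
  cut-atom {p} {Γ} {Δ} d e =
    AtomicCut.reducible e Γ Δ [] [] []
      (Ex (↭-reflexive (sym (++-identityʳ Γ))) (↭-sym (++-comm Δ [ atom p ])) d)

  cut : ∀ φ {Γ Δ} → D (Γ ▷ φ ∷ Δ) → D (φ ∷ Γ ▷ Δ) → D (Γ ▷ Δ)
  cut (atom p) {Γ} {Δ} d e =
    weaken-⊆ (λ x∈ → reduce (∈-++⁻ Γ x∈)) (λ x∈ → reduce (∈-++⁻ Δ x∈)) (cut-atom d e)
  cut (φ ∧̇ ψ) d e = cut φ (∧R-e₁ d) (cut ψ (WL (∧R-e₂ d)) (Ex (↭-swap φ ψ ↭-refl) ↭-refl (∧L-e e)))
  cut (φ ∨̇ ψ) d e = cut ψ (cut φ (∨R-e d) (WR (∨L-e₁ e))) (∨L-e₂ e)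
  cut (-̇ φ)   d e = cut φ (-L-e e) (-R-e d)
  cut ⊤̇       d e = ⊤L-e e
  cut ⊥̇       d e = ⊥R-e d

  cut-admissible : ∀ {φ Γ Δ Γ' Δ'} → D (Γ ▷ φ ∷ Δ) → D (φ ∷ Γ' ▷ Δ') → D (Γ ++ Γ' ▷ Δ ++ Δ')
  cut-admissible {φ} {Γ} {Δ} {Γ'} {Δ'} d e =
    cut φ (weaken-⊆ (xs⊆xs++ys Γ Γ') (xs⊆xs++ys (φ ∷ Δ) Δ') d)
          (weaken-⊆ (∷⁺ʳ φ (xs⊆ys++xs Γ' Γ)) (xs⊆ys++xs Δ' Δ) e)

cut-elimination : ∀ {C s} → Der C true s → Der C false s
cut-elimination (∧R d e)   = ∧R (cut-elimination d) (cut-elimination e)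
cut-elimination (∧L d)     = ∧L (cut-elimination d)
cut-elimination (∨L d e)   = ∨L (cut-elimination d) (cut-elimination e)
cut-elimination (∨R d)     = ∨R (cut-elimination d)
cut-elimination (-R d)     = -R (cut-elimination d)
cut-elimination (-L d)     = -L (cut-elimination d)
cut-elimination ⊤R         = ⊤R
cut-elimination ⊥L         = ⊥L
cut-elimination (∧R-e₁ d)  = ∧R-e₁ (cut-elimination d)
cut-elimination (∧R-e₂ d)  = ∧R-e₂ (cut-elimination d)
cut-elimination (∧L-e d)   = ∧L-e (cut-elimination d)
cut-elimination (∨L-e₁ d)  = ∨L-e₁ (cut-elimination d)
cut-elimination (∨L-e₂ d)  = ∨L-e₂ (cut-elimination d)
cut-elimination (∨R-e d)   = ∨R-e (cut-elimination d)
cut-elimination (-R-e d)   = -R-e (cut-elimination d)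
cut-elimination (-L-e d)   = -L-e (cut-elimination d)
cut-elimination (⊤L-e d)   = ⊤L-e (cut-elimination d)
cut-elimination (⊥R-e d)   = ⊥R-e (cut-elimination d)
cut-elimination (WL d)     = WL (cut-elimination d)
cut-elimination (WR d)     = WR (cut-elimination d)
cut-elimination (CL d)     = CL (cut-elimination d)
cut-elimination (CR d)     = CR (cut-elimination d)
cut-elimination (Ex π ρ d) = Ex π ρ (cut-elimination d)
cut-elimination (St i σ ds) = St i σ (λ j → cut-elimination (ds j))
cut-elimination (Cut _ d e) = cut-admissible (cut-elimination d) (cut-elimination e)

theorem3p11 : (C : Calculus) (s : Seq) → Der C true s → Der C false s
theorem3p11 C s = cut-elimination
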